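{- Let $\mathcal{G}=\langle G_1,\dots,G_L\rangle$ be a non-strict temporal graph on $n$ vertices that admits a non-strict exploration schedule $W$, and let $Q$ be a subset of the components visited by $W$ with $|Q|\in[0,L-1]$. Then there exists a component $C\in\mathcal{C}(\mathcal{G})\setminus Q$ with $C\in G_t$ for some $t\in[L]\setminus T(Q)$ such that $|C\setminus D(Q)|\ge (n-|D(Q)|)/(L-|T(Q)|)$.
   Context: A non-strict temporal graph $\mathcal{G}=\langle G_1,\dots,G_L\rangle$ on vertex set $V$ is a sequence of partitions $G_t$ of $V$ (components). $\mathcal{C}(\mathcal{G})=\bigcup_{t\in[L]}G_t$ is the set of all components, each regarded as associated with its layer (occurrences of the same vertex set in different layers are distinct elements). A non-strict temporal walk visits one component in each of a sequence of consecutive timesteps (consecutive components intersecting) and visits the union of these components; a non-strict exploration schedule is such a walk starting at the start vertex at time $1$ that visits all of $V$. For a set $Q$ of components from distinct layers, $D(Q)=\bigcup_{C\in Q}C$ and $T(Q)=\{t\in[L]:\text{some }C\in Q\text{ is associated with }G_t\}$. -}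

module Defs where

open import Data.Nat using (ℕ; zero; suc; _≤_)
open import Data.Fin using (Fin; zero; suc; inject≤; inject₁)
open import Data.Fin.Subset using (Subset; _∈_; _∉_; _∩_; ⋃; ⁅_⁆; Nonempty)
open import Data.Fin.Subset.Properties using (_∈?_)
open import Data.List using (List; map; filter; allFin; length; lookup)
import Data.List.Membership.Propositional as LM
open import Data.Product using (∃; _×_)
open import Relation.Binary.PropositionalEquality using (_≢_)

IsEmpty : ∀ {n} → Subset n → Set
IsEmpty {n} p = (v : Fin n) → v ∉ p

record IsPartition {n : ℕ} (P : List (Subset n)) : Set where
  field
    nonempty : ∀ (i : Fin (length P)) → Nonempty (lookup P i)
    disjoint : ∀ (i j : Fin (length P)) → i ≢ j → IsEmpty (lookup P i ∩ lookup P j)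
    covers   : ∀ (v : Fin n) → ∃ λ C → C LM.∈ P × v ∈ C

-- A non-strict temporal graph on vertex set Fin n with lifetime L:
-- layer t is the partition G_t of V into components.
record TemporalGraph (n L : ℕ) : Set where
  field
    layer     : Fin L → List (Subset n)
    partition : ∀ t → IsPartition (layer t)
open TemporalGraph public

-- A non-strict exploration schedule from start vertex s: a non-strict temporal
-- walk visiting one component comp i ∈ G_{i} in each of the consecutive
-- timesteps 1,…,len (here indexed 0,…,len-1, with len = suc m ≤ L), starting at s
-- at time 1, with consecutive components intersecting, visiting all of V.
record ExplorationSchedule {n L : ℕ} (G : TemporalGraph n L) (s : Fin n) : Set where
  field
    m         : ℕ
    len≤L     : suc m ≤ L
    comp      : Fin (suc m) → Subset n
    inLayer   : ∀ i → comp i LM.∈ layer G (inject≤ i len≤L)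
    start     : s ∈ comp zero
    linked    : ∀ (i : Fin m) → Nonempty (comp (inject₁ i) ∩ comp (suc i))
    exploring : ∀ (v : Fin n) → ∃ λ i → v ∈ comp i
open ExplorationSchedule public

-- A set Q of components visited by W is given by the set of (walk) timesteps
-- whose visited component belongs to Q.
VisitedSubset : ∀ {n L} {G : TemporalGraph n L} {s} → ExplorationSchedule G s → Set
VisitedSubset W = Subset (suc (m W))

selected : ∀ {k} → Subset k → List (Fin k)
selected {k} Q = filter (_∈? Q) (allFin k)

D : ∀ {n L} {G : TemporalGraph n L} {s} (W : ExplorationSchedule G s) → VisitedSubset W → Subset n
D W Q = ⋃ (map (comp W) (selected Q))

T : ∀ {n L} {G : TemporalGraph n L} {s} (W : ExplorationSchedule G s) → VisitedSubset W → Subset L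
T W Q = ⋃ (map (λ i → ⁅ inject≤ i (len≤L W) ⁆) (selected Q))

-- Let U be the walk steps whose components are not in Q. Every vertex outside D(Q)
-- is visited by the walk, hence lies in the component of some step of U, so the
-- n - |D(Q)| uncovered vertices are spread over at most |U| components and one of
-- them contains at least the average share. Its layer is outside T(Q), and since
-- |T(Q)| is at most the number of steps not in U, |U| ≤ L - |T(Q)|. If U is empty,
-- D(Q) = V and the walk has at most |Q| ≤ L - 1 steps, so its first unused layer
-- lies outside T(Q) and any of its components will do.
module Submission where

open import Defs
open import Data.Nat using (ℕ; suc; _+_; _*_; _∸_; _≤_; _<_; z≤n; s≤s)
open import Data.Nat.Properties
open import Data.Nat.ListAction using (sum)
open import Data.Fin using (Fin; toℕ; inject≤; fromℕ<)
open import Data.Fin.Properties using (toℕ-inject≤; toℕ-fromℕ<; toℕ<n; inject≤-injective)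
open import Data.Fin.Subset
  using (Subset; ∣_∣; _∈_; _∉_; _∪_; _─_; ⋃; ⁅_⁆; ∁; _⊆_; Empty; inside; outside)
open import Data.Fin.Subset.Properties
open import Data.List using (List; []; _∷_; map; filter; length; allFin)
open import Data.List.Properties using (length-tabulate)
import Data.List.Membership.Propositional as List
open import Data.List.Membership.Propositional.Properties
  using (∈-map⁺; ∈-map⁻; ∈-filter⁺; ∈-filter⁻; ∈-allFin)
open import Data.Vec using ([]; _∷_)
open import Data.List.Relation.Unary.Any using (here; there)
open import Data.Product using (∃; _×_; _,_; proj₂)
open import Data.Sum using (inj₁; inj₂)
open import Data.Empty using (⊥-elim)
open import Relation.Nullary using (yes; no)
open import Relation.Unary using (Pred; Decidable)
open import Relation.Unary.Properties using (∁?)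
open import Relation.Binary.PropositionalEquality
  using (_≡_; refl; sym; trans; cong; subst)

∣p∪q∣≤∣p∣+∣q∣ : ∀ {k} (p q : Subset k) → ∣ p ∪ q ∣ ≤ ∣ p ∣ + ∣ q ∣
∣p∪q∣≤∣p∣+∣q∣ []            []            = z≤n
∣p∪q∣≤∣p∣+∣q∣ (inside  ∷ p) (inside  ∷ q) =
  s≤s (≤-trans (m≤n⇒m≤1+n (∣p∪q∣≤∣p∣+∣q∣ p q)) (≤-reflexive (sym (+-suc _ _))))
∣p∪q∣≤∣p∣+∣q∣ (inside  ∷ p) (outside ∷ q) = s≤s (∣p∪q∣≤∣p∣+∣q∣ p q)
∣p∪q∣≤∣p∣+∣q∣ (outside ∷ p) (inside  ∷ q) =
  ≤-trans (s≤s (∣p∪q∣≤∣p∣+∣q∣ p q)) (≤-reflexive (sym (+-suc _ _)))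
∣p∪q∣≤∣p∣+∣q∣ (outside ∷ p) (outside ∷ q) = ∣p∪q∣≤∣p∣+∣q∣ p q

∣⋃∣≤sum : ∀ {a} {A : Set a} {k} (g : A → Subset k) (xs : List A) →
  ∣ ⋃ (map g xs) ∣ ≤ sum (map (λ x → ∣ g x ∣) xs)
∣⋃∣≤sum {k = k} g []       = ≤-reflexive (∣⊥∣≡0 k)
∣⋃∣≤sum         g (x ∷ xs) =
  ≤-trans (∣p∪q∣≤∣p∣+∣q∣ (g x) (⋃ (map g xs))) (+-monoʳ-≤ ∣ g x ∣ (∣⋃∣≤sum g xs))

∣⋃⁅⁆∣≤length : ∀ {a} {A : Set a} {k} (g : A → Fin k) (xs : List A) →
  ∣ ⋃ (map (λ x → ⁅ g x ⁆) xs) ∣ ≤ length xs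
∣⋃⁅⁆∣≤length {k = k} g []       = ≤-reflexive (∣⊥∣≡0 k)
∣⋃⁅⁆∣≤length         g (x ∷ xs) =
  ≤-trans (∣p∪q∣≤∣p∣+∣q∣ ⁅ g x ⁆ _)
          (≤-trans (≤-reflexive (cong (_+ _) (∣⁅x⁆∣≡1 (g x)))) (s≤s (∣⋃⁅⁆∣≤length g xs)))

x∈⋃⁺ : ∀ {k} {x : Fin k} {p} (ps : List (Subset k)) → p List.∈ ps → x ∈ p → x ∈ ⋃ ps
x∈⋃⁺ (q ∷ ps) (here refl) x∈p = x∈p∪q⁺ (inj₁ x∈p)
x∈⋃⁺ (q ∷ ps) (there p∈)  x∈p = x∈p∪q⁺ (inj₂ (x∈⋃⁺ ps p∈ x∈p))

x∈⋃⁻ : ∀ {k} {x : Fin k} (ps : List (Subset k)) → x ∈ ⋃ ps → ∃ λ p → p List.∈ ps × x ∈ p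
x∈⋃⁻ []       x∈ = ⊥-elim (∉⊥ x∈)
x∈⋃⁻ (p ∷ ps) x∈ with x∈p∪q⁻ p (⋃ ps) x∈
... | inj₁ x∈p = p , here refl , x∈p
... | inj₂ x∈⋃ with x∈⋃⁻ ps x∈⋃
...   | q , q∈ , x∈q = q , there q∈ , x∈q

length-filter-∁+length-filter : ∀ {a p} {A : Set a} {P : Pred A p} (P? : Decidable P) (xs : List A) →
  length (filter (∁? P?) xs) + length (filter P? xs) ≡ length xs
length-filter-∁+length-filter P? []       = refl
length-filter-∁+length-filter P? (x ∷ xs) with P? x
... | yes _ = trans (+-suc _ _) (cong suc (length-filter-∁+length-filter P? xs))
... | no  _ = cong suc (length-filter-∁+length-filter P? xs)

sum≤length*max : ∀ {a} {A : Set a} (f : A → ℕ) {x : A} {xs : List A} → x List.∈ xs →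
  ∃ λ y → y List.∈ xs × sum (map f xs) ≤ length xs * f y
sum≤length*max f {xs = x ∷ xs} _ = go x xs
  where
  go : ∀ x xs → ∃ λ y → y List.∈ (x ∷ xs) × sum (map f (x ∷ xs)) ≤ length (x ∷ xs) * f y
  go x []       = x , here refl , ≤-refl
  go x (z ∷ xs) with go z xs
  ... | y , y∈ , ≤ly with f x ≤? f y
  ...   | yes fx≤fy = y , there y∈ , +-mono-≤ fx≤fy ≤ly
  ...   | no  fx≰fy =
    x , here refl , +-monoʳ-≤ (f x) (≤-trans ≤ly (*-monoʳ-≤ (length (z ∷ xs)) (<⇒≤ (≰⇒> fx≰fy))))

Empty-∁⇒n∸∣p∣≡0 : ∀ {n} {p : Subset n} → Empty (∁ p) → n ∸ ∣ p ∣ ≡ 0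
Empty-∁⇒n∸∣p∣≡0 {n} {p} ∁p-empty =
  trans (sym (∣∁p∣≡n∸∣p∣ p)) (trans (cong ∣_∣ (Empty-unique ∁p-empty)) (∣⊥∣≡0 n))

module _ {n L} {G : TemporalGraph n L} {s} (W : ExplorationSchedule G s) (Q : VisitedSubset W) where

  layerOf : Fin (suc (m W)) → Fin L
  layerOf i = inject≤ i (len≤L W)

  unselected : List (Fin (suc (m W)))
  unselected = filter (∁? (_∈? Q)) (allFin _)

  ∈-unselected⁺ : ∀ {i} → i ∉ Q → i List.∈ unselected
  ∈-unselected⁺ i∉Q = ∈-filter⁺ (∁? (_∈? Q)) (∈-allFin _) i∉Q

  ∈-unselected⁻ : ∀ {i} → i List.∈ unselected → i ∉ Q
  ∈-unselected⁻ i∈ = proj₂ (∈-filter⁻ (∁? (_∈? Q)) {xs = allFin _} i∈)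

  ∈D⁺ : ∀ {i v} → i ∈ Q → v ∈ comp W i → v ∈ D W Q
  ∈D⁺ i∈Q = x∈⋃⁺ (map (comp W) (selected Q))
                  (∈-map⁺ (comp W) (∈-filter⁺ (_∈? Q) (∈-allFin _) i∈Q))

  ∉D⇒∈unselected-comp : ∀ {v} → v ∉ D W Q → ∃ λ i → i ∉ Q × v ∈ comp W i
  ∉D⇒∈unselected-comp {v} v∉D with exploring W v
  ... | i , v∈ = i , (λ i∈Q → v∉D (∈D⁺ i∈Q v∈)) , v∈

  ∈T⁻ : ∀ {t} → t ∈ T W Q → ∃ λ i → i ∈ Q × t ≡ layerOf i
  ∈T⁻ t∈ with x∈⋃⁻ (map (λ i → ⁅ layerOf i ⁆) (selected Q)) t∈
  ... | p , p∈ , t∈p with ∈-map⁻ (λ i → ⁅ layerOf i ⁆) p∈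
  ...   | i , i∈ , refl =
    i , proj₂ (∈-filter⁻ (_∈? Q) {xs = allFin _} i∈) , x∈⁅y⁆⇒x≡y _ t∈p

  layerOf-∉T : ∀ {i} → i ∉ Q → layerOf i ∉ T W Q
  layerOf-∉T i∉Q t∈ with ∈T⁻ t∈
  ... | j , j∈Q , eq = i∉Q (subst (_∈ Q) (sym (inject≤-injective _ _ _ _ eq)) j∈Q)

  length-unselected≤L∸∣T∣ : length unselected ≤ L ∸ ∣ T W Q ∣
  length-unselected≤L∸∣T∣ = m+n≤o⇒m≤o∸n (length unselected) (begin
    length unselected + ∣ T W Q ∣          ≤⟨ +-monoʳ-≤ _ (∣⋃⁅⁆∣≤length layerOf (selected Q)) ⟩
    length unselected + length (selected Q) ≡⟨ length-filter-∁+length-filter (_∈? Q) (allFin _) ⟩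
    length (allFin (suc (m W)))             ≡⟨ length-tabulate (λ i → i) ⟩
    suc (m W)                               ≤⟨ len≤L W ⟩
    L                                       ∎)
    where open ≤-Reasoning

  n∸∣D∣≤sum-unselected : n ∸ ∣ D W Q ∣ ≤ sum (map (λ i → ∣ comp W i ─ D W Q ∣) unselected)
  n∸∣D∣≤sum-unselected = begin
    n ∸ ∣ D W Q ∣                                     ≡⟨ ∣∁p∣≡n∸∣p∣ (D W Q) ⟨
    ∣ ∁ (D W Q) ∣                                     ≤⟨ p⊆q⇒∣p∣≤∣q∣ uncovered⊆⋃ ⟩
    ∣ ⋃ (map (λ i → comp W i ─ D W Q) unselected) ∣ ≤⟨ ∣⋃∣≤sum (λ i → comp W i ─ D W Q) unselected ⟩
    sum (map (λ i → ∣ comp W i ─ D W Q ∣) unselected) ∎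
    where
    open ≤-Reasoning
    uncovered⊆⋃ : ∁ (D W Q) ⊆ ⋃ (map (λ i → comp W i ─ D W Q) unselected)
    uncovered⊆⋃ v∈∁D with ∉D⇒∈unselected-comp (x∈∁p⇒x∉p v∈∁D)
    ... | i , i∉Q , v∈ = x∈⋃⁺ _ (∈-map⁺ (λ i → comp W i ─ D W Q) (∈-unselected⁺ i∉Q))
                                 (x∈p∧x∉q⇒x∈p─q v∈ (x∈∁p⇒x∉p v∈∁D))

  module _ (∁Q-empty : Empty (∁ Q)) where

    n∸∣D∣≡0 : n ∸ ∣ D W Q ∣ ≡ 0
    n∸∣D∣≡0 = Empty-∁⇒n∸∣p∣≡0 λ (v , v∈∁D) →
      let i , i∉Q , _ = ∉D⇒∈unselected-comp (x∈∁p⇒x∉p v∈∁D) in ∁Q-empty (i , x∉p⇒x∈∁p i∉Q)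

    unused-layer : ∣ Q ∣ ≤ L ∸ 1 → ∃ λ t → t ∉ T W Q
    unused-layer ∣Q∣≤L∸1 = fromℕ< walk<L , fresh
      where
      walk≤L∸1 : suc (m W) ≤ L ∸ 1
      walk≤L∸1 = ≤-trans (m∸n≡0⇒m≤n (Empty-∁⇒n∸∣p∣≡0 ∁Q-empty)) ∣Q∣≤L∸1
      walk<L : suc (m W) < L
      walk<L = subst (_≤ L) (+-comm (suc (m W)) 1)
                     (m≤o∸n⇒m+n≤o (suc (m W)) (≤-trans (s≤s z≤n) (len≤L W)) walk≤L∸1)
      fresh : fromℕ< walk<L ∉ T W Q
      fresh t∈ with ∈T⁻ t∈
      ... | i , _ , eq = <-irrefl toℕi≡walk (toℕ<n i)
        where
        toℕi≡walk : toℕ i ≡ suc (m W)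
        toℕi≡walk = trans (sym (toℕ-inject≤ i (len≤L W)))
                          (trans (cong toℕ (sym eq)) (toℕ-fromℕ< walk<L))

mainTheorem15 : ∀ {n L : ℕ} (G : TemporalGraph n L) (s : Fin n)
    (W : ExplorationSchedule G s) (Q : VisitedSubset W) →
    ∣ Q ∣ ≤ L ∸ 1 →
    ∃ λ (t : Fin L) → t ∉ T W Q × ∃ λ C → C List.∈ layer G t ×
      (n ∸ ∣ D W Q ∣) ≤ ∣ C ─ D W Q ∣ * (L ∸ ∣ T W Q ∣)
mainTheorem15 {n} {L} G s W Q ∣Q∣≤L∸1 with nonempty? (∁ Q)
... | yes (i , i∈∁Q) =
  let y , y∈ , sum≤ = sum≤length*max uncovered (∈-unselected⁺ W Q (x∈∁p⇒x∉p i∈∁Q))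
  in layerOf W Q y , layerOf-∉T W Q (∈-unselected⁻ W Q y∈) , comp W y , inLayer W y , (begin
    n ∸ ∣ D W Q ∣                             ≤⟨ n∸∣D∣≤sum-unselected W Q ⟩
    sum (map uncovered (unselected W Q))      ≤⟨ sum≤ ⟩
    length (unselected W Q) * uncovered y     ≤⟨ *-monoˡ-≤ (uncovered y) (length-unselected≤L∸∣T∣ W Q) ⟩
    (L ∸ ∣ T W Q ∣) * uncovered y             ≡⟨ *-comm (L ∸ ∣ T W Q ∣) (uncovered y) ⟩
    uncovered y * (L ∸ ∣ T W Q ∣)             ∎)
  where
  open ≤-Reasoning
  uncovered : Fin (suc (m W)) → ℕ
  uncovered i = ∣ comp W i ─ D W Q ∣
... | no ∁Q-empty =
  let t , t∉T = unused-layer W Q ∁Q-empty ∣Q∣≤L∸1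
      C , C∈ , _ = IsPartition.covers (partition G t) s
  in t , t∉T , C , C∈ , ≤-trans (≤-reflexive (n∸∣D∣≡0 W Q ∁Q-empty)) z≤n
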